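{- Let $G=(V,E)$ be a complete graph with nonnegative metric edge costs $c$ and fixed vertices $s\neq t$, let $x^*$ be an optimal solution of (L.P.1), and let $0<\tau\le1$. Then $$\sum_{Q\in\mathcal C_\tau}c(e_Q)\le c(x^*).$$
   Context: (L.P.1): minimize $\sum_ec_ex_e$ subject to $x(\delta(s))=x(\delta(t))=1$; $x(\delta(v))=2$ for $v\neq s,t$; $x(\delta(S))\ge1$ for every $s$-$t$ cut $S$; $x(\delta(S))\ge2$ for every $\emptyset\subsetneq S\subsetneq V$ with $|S\cap\{s,t\}|$ even; $0\le x_e\le1$. An $s$-$t$ cut is $S$ with $\emptyset\subsetneq S\subsetneq V$, $|S\cap\{s,t\}|=1$; $\delta(S)$ is the set of edges with exactly one end in $S$; $c(x)=\sum_e c_ex_e$. A $\tau$-narrow cut is an $s$-$t$ cut $Q$ with $x^*(\delta(Q))<1+\tau$; $\mathcal C_\tau$ is the set of all $\tau$-narrow cuts containing $s$; for $Q\in\mathcal C_\tau$, $e_Q$ is a minimum-cost edge of $\delta(Q)$.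
   Formalization: The edge costs $c$, the optimal solution $x^*$ and the parameter $\tau$ are rational, and optimality of $x^*$ is taken among rational feasible points of (L.P.1). -}

module Defs where

open import Data.Nat as ℕ using (ℕ; zero; suc; _%_)
open import Data.Bool using (Bool; true; false; _xor_; T)
open import Data.Fin as Fin using (Fin; toℕ)
open import Data.Fin.Properties using () renaming (_<?_ to _<ᶠ?_)
open import Data.Fin.Subset using (Subset; _∈_; _∉_; _∩_; _∪_; ⁅_⁆; ∣_∣; ∁; Nonempty)
open import Data.Fin.Subset.Properties using (_∈?_; nonempty?; x∈∁p⇒x∉p; x∉p⇒x∈∁p)
open import Data.Vec using (Vec; []; _∷_; lookup)
open import Data.List using (List; []; _∷_; map; _++_; filter; concatMap; allFin; foldr)
open import Data.Product using (_×_; _,_; proj₁; proj₂; ∃)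
open import Data.Rational using (ℚ; 0ℚ; 1ℚ; _+_; _*_; _≤_; _<_)
open import Data.Rational.Properties using (_<?_)
open import Relation.Binary.PropositionalEquality using (_≡_; _≢_)
open import Relation.Nullary using (¬_; Dec; yes; no)
open import Relation.Nullary.Decidable using (_×-dec_)

2ℚ : ℚ
2ℚ = 1ℚ + 1ℚ

-- Vertices of the complete graph K_n are Fin n.
-- An edge {u,v} is represented by the ordered pair (u , v) with u < v.
Edge : ℕ → Set
Edge n = Fin n × Fin n

IsEdge : ∀ {n} → Edge n → Set
IsEdge (u , v) = u Fin.< v

edges : (n : ℕ) → List (Edge n)
edges n = filter (λ e → proj₁ e <ᶠ? proj₂ e)
                 (concatMap (λ u → map (λ v → (u , v)) (allFin n)) (allFin n))

subsets : (n : ℕ) → List (Subset n)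
subsets zero = [] ∷ []
subsets (suc n) = map (true ∷_) (subsets n) ++ map (false ∷_) (subsets n)

sumℚ : List ℚ → ℚ
sumℚ = foldr _+_ 0ℚ

Crosses : ∀ {n} → Subset n → Edge n → Set
Crosses S (u , v) = T (lookup S u xor lookup S v)

crosses? : ∀ {n} (S : Subset n) (e : Edge n) → Dec (Crosses S e)
crosses? S (u , v) with lookup S u xor lookup S v
... | true = yes _
... | false = no (λ ())

δ : ∀ {n} → Subset n → List (Edge n)
δ {n} S = filter (crosses? S) (edges n)

-- x(F) for a list of edges F; edge weights are given as functions on
-- ordered pairs, only their values on pairs (u , v) with u < v are used
weight : ∀ {n} → (Fin n → Fin n → ℚ) → List (Edge n) → ℚ
weight x F = sumℚ (map (λ e → x (proj₁ e) (proj₂ e)) F)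

cost : ∀ {n} → (c x : Fin n → Fin n → ℚ) → ℚ
cost {n} c x = sumℚ (map (λ e → c (proj₁ e) (proj₂ e) * x (proj₁ e) (proj₂ e)) (edges n))

ProperNonempty : ∀ {n} → Subset n → Set
ProperNonempty S = ∃ (λ u → u ∈ S) × ∃ (λ v → v ∉ S)

countST : ∀ {n} → Fin n → Fin n → Subset n → ℕ
countST s t S = ∣ S ∩ (⁅ s ⁆ ∪ ⁅ t ⁆) ∣

IsSTCut : ∀ {n} → Fin n → Fin n → Subset n → Set
IsSTCut s t S = ProperNonempty S × countST s t S ≡ 1

record FeasibleLP1 {n : ℕ} (s t : Fin n) (x : Fin n → Fin n → ℚ) : Set where
  field
    deg-s   : weight x (δ ⁅ s ⁆) ≡ 1ℚ
    deg-t   : weight x (δ ⁅ t ⁆) ≡ 1ℚ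
    deg-v   : ∀ v → v ≢ s → v ≢ t → weight x (δ ⁅ v ⁆) ≡ 2ℚ
    cut-st  : ∀ S → IsSTCut s t S → 1ℚ ≤ weight x (δ S)
    cut-even : ∀ S → ProperNonempty S → countST s t S % 2 ≡ 0 → 2ℚ ≤ weight x (δ S)
    lower   : ∀ u v → u Fin.< v → 0ℚ ≤ x u v
    upper   : ∀ u v → u Fin.< v → x u v ≤ 1ℚ

record OptimalLP1 {n : ℕ} (s t : Fin n) (c x : Fin n → Fin n → ℚ) : Set₁ where
  field
    feasible : FeasibleLP1 s t x
    optimal  : ∀ y → FeasibleLP1 s t y → cost c x ≤ cost c y

record MetricCost {n : ℕ} (c : Fin n → Fin n → ℚ) : Set where
  field
    nonneg : ∀ u v → u ≢ v → 0ℚ ≤ c u v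
    symm   : ∀ u v → u ≢ v → c u v ≡ c v u
    triangle : ∀ u v w → u ≢ v → v ≢ w → u ≢ w → c u w ≤ c u v + c v w

properNonempty? : ∀ {n} (S : Subset n) → Dec (ProperNonempty S)
properNonempty? S with nonempty? S | nonempty? (∁ S)
... | yes p | yes (v , v∈∁S) = yes (p , (v , x∈∁p⇒x∉p v∈∁S))
... | no ¬p | _ = no (λ q → ¬p (proj₁ q))
... | yes _ | no ¬q = no (λ q → ¬q (proj₁ (proj₂ q) , x∉p⇒x∈∁p (proj₂ (proj₂ q))))

InNarrow : ∀ {n} (s t : Fin n) (x : Fin n → Fin n → ℚ) (τ : ℚ) (Q : Subset n) → Set
InNarrow s t x τ Q = (IsSTCut s t Q × s ∈ Q) × weight x (δ Q) < 1ℚ + τ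

narrow? : ∀ {n} (s t : Fin n) (x : Fin n → Fin n → ℚ) (τ : ℚ) (Q : Subset n) →
          Dec (InNarrow s t x τ Q)
narrow? s t x τ Q =
  ((properNonempty? Q ×-dec (countST s t Q ℕ.≟ 1)) ×-dec (s ∈? Q))
  ×-dec (weight x (δ Q) <? (1ℚ + τ))

-- 𝒞_τ as a list (each subset exactly once)
narrowCuts : ∀ {n} (s t : Fin n) (x : Fin n → Fin n → ℚ) (τ : ℚ) → List (Subset n)
narrowCuts {n} s t x τ = filter (narrow? s t x τ) (subsets n)

MinCostEdgeOf : ∀ {n} (c : Fin n → Fin n → ℚ) (Q : Subset n) (e : Edge n) → Set
MinCostEdgeOf c Q e =
  (IsEdge e × Crosses Q e) ×
  (∀ f → IsEdge f → Crosses Q f → c (proj₁ e) (proj₂ e) ≤ c (proj₁ f) (proj₂ f))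

-- Two τ-narrow cuts A, B containing s must be nested: otherwise A ∖ B and B ∖ A are
-- nonempty and avoid s and t, so each has boundary weight at least 2, while posimodularity
-- gives x(δ(A ∖ B)) + x(δ(B ∖ A)) ≤ x(δ(A)) + x(δ(B)) < 4. For a chain Q₁ ⊂ ⋯ ⊂ Q_k of
-- s-t cuts the layers Q_{i+1} ∖ Q_i are again such even cuts, and counting their boundaries
-- gives the Hall-type bound x(δ(Q₁) ∪ ⋯ ∪ δ(Q_k)) ≥ k for every subchain. Since
-- c(e_Q) ≤ c_e for every e ∈ δ(Q), a greedy argument (charge the smallest c(e_Q) to all of
-- ⋃ δ(Q) and recurse) turns these bounds into Σ_Q c(e_Q) ≤ c(x*).

module Submission where

open import Data.Bool using (Bool; true; false; T; not; _∧_; _∨_; _xor_)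
open import Data.Bool.Properties using (∨-assoc; ∨-comm; ∨-identityʳ; T-∨)
open import Data.Empty using (⊥-elim)
open import Data.Fin as Fin using (Fin)
open import Data.Fin.Properties using (<⇒≢)
open import Data.Fin.Subset using (Subset; _∈_; _∉_; _⊆_; _⊂_; _∩_; _∪_; ∁; ⁅_⁆; ∣_∣; Empty)
open import Data.Fin.Subset.Properties
  using (x∈p∩q⁺; x∈p∩q⁻; x∈p∪q⁺; x∈p∪q⁻; x∈⁅x⁆; x∈⁅y⁆⇒x≡y; x∈∁p⇒x∉p; x∉p⇒x∈∁p;
         nonempty?; _∈?_; _⊆?_; ⊆-antisym; ⊂-trans; p⊆p∪q; p⊆q⇒∣p∣≤∣q∣; p⊂q⇒∣p∣<∣q∣;
         ∣⁅x⁆∣≡1; ∣⊥∣≡0; Empty-unique)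
open import Data.Bool.ListAction using (any)
open import Data.List using (List; []; _∷_; map; length; filter; concatMap; allFin)
open import Data.List.Properties using (map-cong)
open import Data.List.Membership.Propositional using () renaming (_∈_ to _∈ₗ_)
open import Data.List.Membership.Propositional.Properties using (∈-map⁻)
open import Data.List.Relation.Unary.All as All using (All; []; _∷_)
open import Data.List.Relation.Unary.All.Properties using (all-filter)
open import Data.List.Relation.Unary.AllPairs using (AllPairs; []; _∷_)
import Data.List.Relation.Unary.AllPairs.Properties as AllPairs
import Data.List.Relation.Unary.Any as Any
open import Data.List.Relation.Unary.Any.Properties using (any⁺; any⁻)
open import Data.List.Relation.Unary.Unique.Propositional using (Unique)
import Data.List.Relation.Unary.Unique.Propositional.Properties as Unique
open import Data.Nat as ℕ using (ℕ; zero; suc; _%_; s≤s)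
import Data.Nat.Properties as ℕ
open import Data.Product using (_×_; _,_; proj₁; proj₂; ∃; ∃₂)
open import Data.Rational using (ℚ; 0ℚ; 1ℚ; _+_; _*_; _-_; -_; _≤_; _<_; nonNegative)
open import Data.Rational.Properties
  using (≤-refl; ≤-trans; ≤-total; <-irrefl; <-≤-trans; ≤ᵇ⇒≤; +-mono-≤; +-monoˡ-≤; +-monoʳ-≤;
         +-mono-<; +-inverseʳ; *-identityˡ; *-identityʳ; *-zeroˡ; *-zeroʳ; +-identityˡ; *-monoʳ-≤-nonNeg;
         *-monoˡ-≤-nonNeg; *-cancelˡ-≤-pos; module ≤-Reasoning)
open import Data.Rational.Solver using (module +-*-Solver)
open import Data.Sum as Sum using (_⊎_; inj₁; inj₂)
open import Data.Vec using (_∷_; lookup)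
open import Data.Vec.Properties using (∷-injectiveʳ; []=⇒lookup; lookup⇒[]=; lookup-zipWith; lookup-map)
open import Relation.Binary.Definitions using (Transitive)
open import Relation.Binary.PropositionalEquality
open import Function using (_∘_; Equivalence)
open import Relation.Nullary using (¬_; yes; no; contradiction)

open import Defs

open +-*-Solver using (solve; _:+_; _:-_; _:*_; _:=_; con)

lengthℚ : {A : Set} → List A → ℚ
lengthℚ xs = sumℚ (map (λ _ → 1ℚ) xs)

𝟙 : Bool → ℚ
𝟙 true  = 1ℚ
𝟙 false = 0ℚ

𝟙-T : ∀ {b} → T b → 𝟙 b ≡ 1ℚ
𝟙-T {true} _ = refl

p≤q⇒0≤q-p : ∀ {p q} → p ≤ q → 0ℚ ≤ q - p
p≤q⇒0≤q-p {p} {q} p≤q = subst (_≤ q - p) (+-inverseʳ p) (+-monoˡ-≤ (- p) p≤q)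

+-cancelʳ-≤ : ∀ {p q} r → p + r ≤ q + r → p ≤ q
+-cancelʳ-≤ {p} {q} r p+r≤q+r =
  subst₂ _≤_ (cancel p) (cancel q) (+-monoˡ-≤ (- r) p+r≤q+r)
  where
  cancel : ∀ a → a + r - r ≡ a
  cancel a = solve 2 (λ a r → a :+ r :- r := a) refl a r

*𝟙≤ : ∀ {μ h} b → (T b → μ ≤ h) → 0ℚ ≤ h → μ * 𝟙 b ≤ h
*𝟙≤ {μ} true  μ≤h _   = subst (_≤ _) (sym (*-identityʳ μ)) (μ≤h _)
*𝟙≤ {μ} false _   0≤h = subst (_≤ _) (sym (*-zeroʳ μ)) 0≤h

sumℚ-map-sub : {A : Set} (d : A → ℚ) (μ : ℚ) → ∀ xs →
               sumℚ (map (λ y → d y - μ) xs) ≡ sumℚ (map d xs) - lengthℚ xs * μ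
sumℚ-map-sub d μ [] = solve 1 (λ μ → con 0ℚ := con 0ℚ :- con 0ℚ :* μ) refl μ
sumℚ-map-sub d μ (y ∷ ys) = begin
  d y - μ + sumℚ (map (λ y → d y - μ) ys)   ≡⟨ cong (d y - μ +_) (sumℚ-map-sub d μ ys) ⟩
  d y - μ + (S - K * μ)
    ≡⟨ solve 4 (λ a μ S K → a :- μ :+ (S :- K :* μ) := a :+ S :- (con 1ℚ :+ K) :* μ) refl (d y) μ S K ⟩
  d y + S - (1ℚ + K) * μ                    ∎
  where
  open ≡-Reasoning
  S = sumℚ (map d ys)
  K = lengthℚ ys

data Select {A : Set} : A → List A → List A → Set where
  here  : ∀ {x xs} → Select x (x ∷ xs) xs
  there : ∀ {x y xs ys} → Select x xs ys → Select x (y ∷ xs) (y ∷ ys)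

module _ {A : Set} where

  select-length : ∀ {x : A} {xs ys} → Select x xs ys → length xs ≡ suc (length ys)
  select-length here      = refl
  select-length (there p) = cong suc (select-length p)

  select-lookup : ∀ {P : A → Set} {x xs ys} → Select x xs ys → All P xs → P x
  select-lookup here      (px ∷ _)  = px
  select-lookup (there p) (_  ∷ ps) = select-lookup p ps

  select-All : ∀ {P : A → Set} {x xs ys} → Select x xs ys → All P xs → All P ys
  select-All here      (_  ∷ ps) = ps
  select-All (there p) (py ∷ ps) = py ∷ select-All p ps

  unselect-All : ∀ {P : A → Set} {x xs ys} → Select x xs ys → P x → All P ys → All P xs
  unselect-All here      px ps        = px ∷ ps
  unselect-All (there p) px (py ∷ ps) = py ∷ unselect-All p px ps

  select-AllPairs : ∀ {R : A → A → Set} {x xs ys} → Select x xs ys → AllPairs R xs → AllPairs R ys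
  select-AllPairs here      (_  ∷ rs) = rs
  select-AllPairs (there p) (ry ∷ rs) = select-All p ry ∷ select-AllPairs p rs

  select-sum : (d : A → ℚ) → ∀ {x xs ys} → Select x xs ys
             → sumℚ (map d xs) ≡ d x + sumℚ (map d ys)
  select-sum d here = refl
  select-sum d {x} (there {y = y} {xs} {ys} p) = begin
    d y + sumℚ (map d xs)         ≡⟨ cong (d y +_) (select-sum d p) ⟩
    d y + (d x + sumℚ (map d ys)) ≡⟨ solve 3 (λ a b c → a :+ (b :+ c) := b :+ (a :+ c)) refl
                                              (d y) (d x) (sumℚ (map d ys)) ⟩
    d x + (d y + sumℚ (map d ys)) ∎
    where open ≡-Reasoning

  select-sum-shift : (d : A → ℚ) → ∀ {m xs ys} → Select m xs ys
                   → sumℚ (map d xs) ≡ sumℚ (map (λ y → d y - d m) ys) + d m * lengthℚ xs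
  select-sum-shift d {m} {xs} {ys} sel = begin
    sumℚ (map d xs)
      ≡⟨ select-sum d sel ⟩
    d m + S
      ≡⟨ solve 3 (λ μ S K → μ :+ S := S :- K :* μ :+ μ :* (con 1ℚ :+ K)) refl (d m) S (lengthℚ ys) ⟩
    S - lengthℚ ys * d m + d m * (1ℚ + lengthℚ ys)
      ≡⟨ cong₂ (λ a b → a + d m * b) (sym (sumℚ-map-sub d (d m) ys)) (sym (select-sum (λ _ → 1ℚ) sel)) ⟩
    sumℚ (map (λ y → d y - d m) ys) + d m * lengthℚ xs
      ∎
    where
    open ≡-Reasoning
    S = sumℚ (map d ys)

  select-any : (f : A → Bool) → ∀ {x xs ys} → Select x xs ys → any f xs ≡ f x ∨ any f ys
  select-any f here = refl
  select-any f {x} (there {y = y} {xs} {ys} p) = begin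
    f y ∨ any f xs           ≡⟨ cong (f y ∨_) (select-any f p) ⟩
    f y ∨ (f x ∨ any f ys)   ≡⟨ ∨-assoc (f y) (f x) _ ⟨
    (f y ∨ f x) ∨ any f ys   ≡⟨ cong (_∨ any f ys) (∨-comm (f y) (f x)) ⟩
    (f x ∨ f y) ∨ any f ys   ≡⟨ ∨-assoc (f x) (f y) _ ⟩
    f x ∨ (f y ∨ any f ys)   ∎
    where open ≡-Reasoning

  select-top : ∀ {R : A → A → Set} → Transitive R
             → ∀ x xs → AllPairs (λ a b → R a b ⊎ R b a) (x ∷ xs)
             → ∃₂ λ m ys → Select m (x ∷ xs) ys × All (λ y → R y m) ys
  select-top R-trans x []       _            = x , [] , here , []
  select-top R-trans x (y ∷ ys) (x≶ ∷ ys≶) with select-top R-trans y ys ys≶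
  ... | m , zs , p , below with select-lookup p x≶
  ...   | inj₁ x<m = m , x ∷ zs , there p , x<m ∷ below
  ...   | inj₂ m<x = x , y ∷ ys , here , unselect-All p m<x (All.map (λ z<m → R-trans z<m m<x) below)

  select-min : (d : A → ℚ) → ∀ x xs
             → ∃₂ λ m ys → Select m (x ∷ xs) ys × All (λ y → d m ≤ d y) ys
  select-min d x xs = select-top (λ p q → ≤-trans q p) x xs (total (x ∷ xs))
    where
    total : ∀ zs → AllPairs (λ a b → d b ≤ d a ⊎ d a ≤ d b) zs
    total []       = []
    total (z ∷ zs) = All.universal (λ w → ≤-total (d w) (d z)) zs ∷ total zs

  Unique⇒AllPairs : ∀ {P : A → Set} {R : A → A → Set}
                  → (∀ {a b} → P a → P b → a ≢ b → R a b)
                  → ∀ {xs} → All P xs → Unique xs → AllPairs R xs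
  Unique⇒AllPairs r []        []         = []
  Unique⇒AllPairs r (pa ∷ ps) (a≢ ∷ a≢s) =
    All.zipWith (λ (pb , a≢b) → r pa pb a≢b) (ps , a≢) ∷ Unique⇒AllPairs r ps a≢s

subsets-unique : ∀ n → Unique (subsets n)
subsets-unique zero    = [] ∷ []
subsets-unique (suc n) = Unique.++⁺ (Unique.map⁺ ∷-injectiveʳ (subsets-unique n))
                                    (Unique.map⁺ ∷-injectiveʳ (subsets-unique n)) disjoint
  where
  disjoint : ∀ {p} → ¬ (p ∈ₗ map (true ∷_) (subsets n) × p ∈ₗ map (false ∷_) (subsets n))
  disjoint (p∈₁ , p∈₂) with ∈-map⁻ (true ∷_) p∈₁ | ∈-map⁻ (false ∷_) p∈₂
  ... | _ , _ , refl | _ , _ , ()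

module _ {n : ℕ} where

  ∈∖⁺ : ∀ {A B : Subset n} {u} → u ∈ A → u ∉ B → u ∈ A ∩ ∁ B
  ∈∖⁺ u∈A u∉B = x∈p∩q⁺ (u∈A , x∉p⇒x∈∁p u∉B)

  ∈∖⁻ : ∀ {A B : Subset n} {u} → u ∈ A ∩ ∁ B → u ∈ A × u ∉ B
  ∈∖⁻ {A} {B} u∈A∖B with x∈p∩q⁻ A (∁ B) u∈A∖B
  ... | u∈A , u∈∁B = u∈A , x∈∁p⇒x∉p u∈∁B

  ⊈⇒∃∈∉ : ∀ {A B : Subset n} → ¬ (A ⊆ B) → ∃ λ u → u ∈ A × u ∉ B
  ⊈⇒∃∈∉ {A} {B} A⊈B with nonempty? (A ∩ ∁ B)
  ... | yes (u , u∈A∖B) = u , ∈∖⁻ u∈A∖B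
  ... | no  A∖B-empty   = ⊥-elim (A⊈B λ {u} → A⊆B {u})
    where
    A⊆B : A ⊆ B
    A⊆B {u} u∈A with u ∈? B
    ... | yes u∈B = u∈B
    ... | no  u∉B = contradiction (u , ∈∖⁺ u∈A u∉B) A∖B-empty

  countST-both : ∀ {s t : Fin n} {Q} → s ≢ t → s ∈ Q → t ∈ Q → 2 ℕ.≤ countST s t Q
  countST-both {s} {t} {Q} s≢t s∈Q t∈Q =
    subst (ℕ._≤ countST s t Q) (cong suc (∣⁅x⁆∣≡1 s))
      (ℕ.≤-trans (p⊂q⇒∣p∣<∣q∣ s⊂st) (p⊆q⇒∣p∣≤∣q∣ st⊆Q∩st))
    where
    s⊂st : ⁅ s ⁆ ⊂ ⁅ s ⁆ ∪ ⁅ t ⁆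
    s⊂st = p⊆p∪q _ , t , x∈p∪q⁺ (inj₂ (x∈⁅x⁆ t))
         , λ t∈⁅s⁆ → s≢t (sym (x∈⁅y⁆⇒x≡y s t∈⁅s⁆))
    st⊆Q∩st : ⁅ s ⁆ ∪ ⁅ t ⁆ ⊆ Q ∩ (⁅ s ⁆ ∪ ⁅ t ⁆)
    st⊆Q∩st {u} u∈st with x∈p∪q⁻ ⁅ s ⁆ ⁅ t ⁆ u∈st
    ... | inj₁ u∈⁅s⁆ = x∈p∩q⁺ (subst (_∈ Q) (sym (x∈⁅y⁆⇒x≡y s u∈⁅s⁆)) s∈Q , u∈st)
    ... | inj₂ u∈⁅t⁆ = x∈p∩q⁺ (subst (_∈ Q) (sym (x∈⁅y⁆⇒x≡y t u∈⁅t⁆)) t∈Q , u∈st)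

  countST-none : ∀ {s t : Fin n} {D} → s ∉ D → t ∉ D → countST s t D ≡ 0
  countST-none {s} {t} {D} s∉D t∉D = trans (cong ∣_∣ (Empty-unique empty)) (∣⊥∣≡0 n)
    where
    empty : Empty (D ∩ (⁅ s ⁆ ∪ ⁅ t ⁆))
    empty (u , u∈) with x∈p∩q⁻ D _ u∈
    ... | u∈D , u∈st with x∈p∪q⁻ ⁅ s ⁆ ⁅ t ⁆ u∈st
    ... | inj₁ u∈⁅s⁆ = s∉D (subst (_∈ D) (x∈⁅y⁆⇒x≡y s u∈⁅s⁆) u∈D)
    ... | inj₂ u∈⁅t⁆ = t∉D (subst (_∈ D) (x∈⁅y⁆⇒x≡y t u∈⁅t⁆) u∈D)

  st-cut⇒t∉ : ∀ {s t : Fin n} {Q} → s ≢ t → s ∈ Q → countST s t Q ≡ 1 → t ∉ Q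
  st-cut⇒t∉ s≢t s∈Q count≡1 t∈Q =
    contradiction (subst (2 ℕ.≤_) count≡1 (countST-both s≢t s∈Q t∈Q)) λ { (s≤s ()) }

  ∈⇒T : ∀ {S : Subset n} {u} → u ∈ S → T (lookup S u)
  ∈⇒T u∈S rewrite []=⇒lookup u∈S = _

  T⇒∈ : ∀ {S : Subset n} {u} → T (lookup S u) → u ∈ S
  T⇒∈ {S} {u} t with lookup S u in eq
  ... | true = lookup⇒[]= u S eq

crossesᵇ : ∀ {n} → Subset n → Edge n → Bool
crossesᵇ S (u , v) = lookup S u xor lookup S v

χ : ∀ {n} → Subset n → Edge n → ℚ
χ S e = 𝟙 (crossesᵇ S e)

crossesAny : ∀ {n} → List (Subset n) → Edge n → Bool
crossesAny L e = any (λ Q → crossesᵇ Q e) L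

module _ {n : ℕ} where

  crosses-∖ : ∀ (A B : Subset n) u v → crossesᵇ (A ∩ ∁ B) (u , v)
            ≡ (lookup A u ∧ not (lookup B u)) xor (lookup A v ∧ not (lookup B v))
  crosses-∖ A B u v = cong₂ _xor_ (lookup-∖ u) (lookup-∖ v)
    where
    lookup-∖ : ∀ w → lookup (A ∩ ∁ B) w ≡ (lookup A w ∧ not (lookup B w))
    lookup-∖ w = trans (lookup-zipWith _∧_ w A (∁ B)) (cong (lookup A w ∧_) (lookup-map w not B))

  crosses⇒endpoint : ∀ (S : Subset n) u v → Crosses S (u , v) → u ∈ S ⊎ v ∈ S
  crosses⇒endpoint S u v uv∈δS with lookup S u in eq
  ... | true  = inj₁ (lookup⇒[]= u S eq)
  ... | false = inj₂ (T⇒∈ uv∈δS)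

  crossesAny-select : ∀ {Q L L'} {e : Edge n} → Select Q L L'
                    → crossesAny L e ≡ crossesᵇ Q e ∨ crossesAny L' e
  crossesAny-select {e = e} = select-any (λ Q → crossesᵇ Q e)

  crossesAny-All : ∀ L → All (λ Q → ∀ {e : Edge n} → Crosses Q e → T (crossesAny L e)) L
  crossesAny-All L = All.tabulate λ Q∈L e∈δQ → any⁺ _ (Any.map (λ { refl → e∈δQ }) Q∈L)

  crossesAny⇒touches : ∀ {P : Subset n} {L} u v → All (_⊆ P) L → T (crossesAny L (u , v))
                     → T (lookup P u ∨ lookup P v)
  crossesAny⇒touches u v L⊆P uv∈δL with All.lookupAny L⊆P (any⁻ _ _ uv∈δL)
  ... | R⊆P , uv∈δR =
    Equivalence.from T-∨ (Sum.map (∈⇒T ∘ R⊆P) (∈⇒T ∘ R⊆P) (crosses⇒endpoint _ u v uv∈δR))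

posimodular-pointwise : ∀ a₁ a₂ b₁ b₂
  → 𝟙 ((a₁ ∧ not b₁) xor (a₂ ∧ not b₂)) + 𝟙 ((b₁ ∧ not a₁) xor (b₂ ∧ not a₂))
  ≤ 𝟙 (a₁ xor a₂) + 𝟙 (b₁ xor b₂)
posimodular-pointwise true  true  true  true  = ≤ᵇ⇒≤ _
posimodular-pointwise true  true  true  false = ≤ᵇ⇒≤ _
posimodular-pointwise true  true  false true  = ≤ᵇ⇒≤ _
posimodular-pointwise true  true  false false = ≤ᵇ⇒≤ _
posimodular-pointwise true  false true  true  = ≤ᵇ⇒≤ _
posimodular-pointwise true  false true  false = ≤ᵇ⇒≤ _
posimodular-pointwise true  false false true  = ≤ᵇ⇒≤ _
posimodular-pointwise true  false false false = ≤ᵇ⇒≤ _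
posimodular-pointwise false true  true  true  = ≤ᵇ⇒≤ _
posimodular-pointwise false true  true  false = ≤ᵇ⇒≤ _
posimodular-pointwise false true  false true  = ≤ᵇ⇒≤ _
posimodular-pointwise false true  false false = ≤ᵇ⇒≤ _
posimodular-pointwise false false true  true  = ≤ᵇ⇒≤ _
posimodular-pointwise false false true  false = ≤ᵇ⇒≤ _
posimodular-pointwise false false false true  = ≤ᵇ⇒≤ _
posimodular-pointwise false false false false = ≤ᵇ⇒≤ _

-- pᵢ and qᵢ say whether the i-th endpoint of an edge lies in cuts P ⊆ Q, and a whether the
-- edge crosses some cut of a family of subsets of P that contains P itself.
chain-step-pointwise : ∀ p₁ p₂ q₁ q₂ a
  → (T p₁ → T q₁) → (T p₂ → T q₂) → (T a → T (p₁ ∨ p₂)) → (T (p₁ xor p₂) → T a)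
  → 2ℚ * 𝟙 a + 𝟙 (q₁ xor q₂) + 𝟙 ((q₁ ∧ not p₁) xor (q₂ ∧ not p₂))
  ≤ 2ℚ * 𝟙 ((q₁ xor q₂) ∨ a) + 𝟙 (p₁ xor p₂)
chain-step-pointwise true  _     false _     _     p₁⇒q₁ _     _   _   = ⊥-elim (p₁⇒q₁ _)
chain-step-pointwise _     true  _     false _     _     p₂⇒q₂ _   _   = ⊥-elim (p₂⇒q₂ _)
chain-step-pointwise false false _     _     true  _     _     a⇒p _   = ⊥-elim (a⇒p _)
chain-step-pointwise true  false _     _     false _     _     _   p⇒a = ⊥-elim (p⇒a _)
chain-step-pointwise false true  _     _     false _     _     _   p⇒a = ⊥-elim (p⇒a _)
chain-step-pointwise false false true  true  false _ _ _ _ = ≤ᵇ⇒≤ _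
chain-step-pointwise false false true  false false _ _ _ _ = ≤ᵇ⇒≤ _
chain-step-pointwise false false false true  false _ _ _ _ = ≤ᵇ⇒≤ _
chain-step-pointwise false false false false false _ _ _ _ = ≤ᵇ⇒≤ _
chain-step-pointwise true  false true  true  true  _ _ _ _ = ≤ᵇ⇒≤ _
chain-step-pointwise true  false true  false true  _ _ _ _ = ≤ᵇ⇒≤ _
chain-step-pointwise false true  true  true  true  _ _ _ _ = ≤ᵇ⇒≤ _
chain-step-pointwise false true  false true  true  _ _ _ _ = ≤ᵇ⇒≤ _
chain-step-pointwise true  true  true  true  true  _ _ _ _ = ≤ᵇ⇒≤ _
chain-step-pointwise true  true  true  true  false _ _ _ _ = ≤ᵇ⇒≤ _

-- Edge functions integrated against an edge weighting

module Integral {n : ℕ} (x : Fin n → Fin n → ℚ) (x≥0 : ∀ u v → u Fin.< v → 0ℚ ≤ x u v) where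

  xₑ : Edge n → ℚ
  xₑ e = x (proj₁ e) (proj₂ e)

  ∫[_]_ : List (Edge n) → (Edge n → ℚ) → ℚ
  ∫[ es ] f = sumℚ (map (λ e → f e * xₑ e) es)

  ∫ : (Edge n → ℚ) → ℚ
  ∫ f = ∫[ edges n ] f

  unionWeight : List (Subset n) → ℚ
  unionWeight L = ∫ (λ e → 𝟙 (crossesAny L e))

  weight-δ : ∀ S → weight x (δ S) ≡ ∫ (χ S)
  weight-δ S = go (edges n)
    where
    go : ∀ es → weight x (filter (crosses? S) es) ≡ ∫[ es ] χ S
    go [] = refl
    go ((u , v) ∷ es) with lookup S u xor lookup S v
    ... | true  = cong₂ _+_ (sym (*-identityˡ (x u v))) (go es)
    ... | false = trans (go es) (sym (trans (cong (_+ _) (*-zeroˡ (x u v))) (+-identityˡ _)))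

  ∫-mono : ∀ {f g} → (∀ e → IsEdge e → f e ≤ g e) → ∫ f ≤ ∫ g
  ∫-mono {f} {g} f≤g = go edges-IsEdge
    where
    edges-IsEdge : All IsEdge (edges n)
    edges-IsEdge = all-filter (λ e → proj₁ e Fin.<? proj₂ e)
                              (concatMap (λ u → map (u ,_) (allFin n)) (allFin n))
    go : ∀ {es} → All IsEdge es → ∫[ es ] f ≤ ∫[ es ] g
    go []                        = ≤-refl
    go {(u , v) ∷ _} (u<v ∷ ok) =
      +-mono-≤ (*-monoʳ-≤-nonNeg (x u v) {{nonNegative (x≥0 u v u<v)}} (f≤g _ u<v)) (go ok)

  ∫-cong : ∀ {f g} → (∀ e → f e ≡ g e) → ∫ f ≡ ∫ g
  ∫-cong f≡g = cong sumℚ (map-cong (λ e → cong (_* xₑ e) (f≡g e)) (edges n))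

  ∫-+ : ∀ f g → ∫ (λ e → f e + g e) ≡ ∫ f + ∫ g
  ∫-+ f g = go (edges n)
    where
    go : ∀ es → ∫[ es ] (λ e → f e + g e) ≡ ∫[ es ] f + ∫[ es ] g
    go []       = refl
    go (e ∷ es) = trans (cong ((f e + g e) * xₑ e +_) (go es))
      (solve 5 (λ a b w A B → (a :+ b) :* w :+ (A :+ B) := a :* w :+ A :+ (b :* w :+ B)) refl
               (f e) (g e) (xₑ e) (∫[ es ] f) (∫[ es ] g))

  ∫-scale : ∀ k f → ∫ (λ e → k * f e) ≡ k * ∫ f
  ∫-scale k f = go (edges n)
    where
    go : ∀ es → ∫[ es ] (λ e → k * f e) ≡ k * ∫[ es ] f
    go []       = solve 1 (λ k → con 0ℚ := k :* con 0ℚ) refl k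
    go (e ∷ es) = trans (cong (k * f e * xₑ e +_) (go es))
      (solve 4 (λ k a w A → k :* a :* w :+ k :* A := k :* (a :* w :+ A)) refl k (f e) (xₑ e) (∫[ es ] f))

  ∫-sub : ∀ f k g → ∫ (λ e → f e - k * g e) ≡ ∫ f - k * ∫ g
  ∫-sub f k g = go (edges n)
    where
    go : ∀ es → ∫[ es ] (λ e → f e - k * g e) ≡ ∫[ es ] f - k * ∫[ es ] g
    go []       = solve 1 (λ k → con 0ℚ := con 0ℚ :- k :* con 0ℚ) refl k
    go (e ∷ es) = trans (cong ((f e - k * g e) * xₑ e +_) (go es))
      (solve 6 (λ a k b w A B → (a :- k :* b) :* w :+ (A :- k :* B) := a :* w :+ A :- k :* (b :* w :+ B)) refl
               (f e) k (g e) (xₑ e) (∫[ es ] f) (∫[ es ] g))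

  ∫-nonneg : ∀ {f} → (∀ e → IsEdge e → 0ℚ ≤ f e) → 0ℚ ≤ ∫ f
  ∫-nonneg {f} f≥0 = begin
    0ℚ                   ≡⟨ *-zeroˡ (∫ f) ⟨
    0ℚ * ∫ f             ≡⟨ ∫-scale 0ℚ f ⟨
    ∫ (λ e → 0ℚ * f e)   ≡⟨ ∫-cong (λ e → *-zeroˡ (f e)) ⟩
    ∫ (λ _ → 0ℚ)         ≤⟨ ∫-mono f≥0 ⟩
    ∫ f                  ∎
    where open ≤-Reasoning

  ∫-posimodular : ∀ A B → ∫ (χ (A ∩ ∁ B)) + ∫ (χ (B ∩ ∁ A)) ≤ ∫ (χ A) + ∫ (χ B)
  ∫-posimodular A B = begin
    ∫ (χ (A ∩ ∁ B)) + ∫ (χ (B ∩ ∁ A))          ≡⟨ ∫-+ (χ (A ∩ ∁ B)) (χ (B ∩ ∁ A)) ⟨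
    ∫ (λ e → χ (A ∩ ∁ B) e + χ (B ∩ ∁ A) e)    ≤⟨ ∫-mono pointwise ⟩
    ∫ (λ e → χ A e + χ B e)                    ≡⟨ ∫-+ (χ A) (χ B) ⟩
    ∫ (χ A) + ∫ (χ B)                          ∎
    where
    open ≤-Reasoning
    pointwise : ∀ e → IsEdge e → χ (A ∩ ∁ B) e + χ (B ∩ ∁ A) e ≤ χ A e + χ B e
    pointwise (u , v) _ rewrite crosses-∖ A B u v | crosses-∖ B A u v =
      posimodular-pointwise (lookup A u) (lookup A v) (lookup B u) (lookup B v)

-- Chains of s-t cuts

module Cuts {n : ℕ} (x : Fin n → Fin n → ℚ) (x≥0 : ∀ u v → u Fin.< v → 0ℚ ≤ x u v)
            (s t : Fin n)
            (even-cut : ∀ D → ProperNonempty D → countST s t D % 2 ≡ 0 → 2ℚ ≤ weight x (δ D)) where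

  open Integral x x≥0

  Separating : Subset n → Set
  Separating Q = s ∈ Q × t ∉ Q × 1ℚ ≤ ∫ (χ Q)

  Nested : Subset n → Subset n → Set
  Nested A B = A ⊂ B ⊎ B ⊂ A

  Chain : List (Subset n) → Set
  Chain L = All Separating L × AllPairs Nested L

  select-Chain : ∀ {Q L L'} → Select Q L L' → Chain L → Chain L'
  select-Chain sel (seps , nested) = select-All sel seps , select-AllPairs sel nested

  difference-even : ∀ {A B u} → s ∈ B → t ∉ A → u ∈ A → u ∉ B → 2ℚ ≤ ∫ (χ (A ∩ ∁ B))
  difference-even {A} {B} {u} s∈B t∉A u∈A u∉B =
    subst (2ℚ ≤_) (weight-δ D)
          (even-cut D ((u , ∈∖⁺ u∈A u∉B) , (t , t∉D)) (cong (_% 2) (countST-none s∉D t∉D)))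
    where
    D = A ∩ ∁ B
    s∉D : s ∉ D
    s∉D s∈D = proj₂ (∈∖⁻ s∈D) s∈B
    t∉D : t ∉ D
    t∉D t∈D = t∉A (proj₁ (∈∖⁻ t∈D))

  light-separating-nested : ∀ {A B} → Separating A → Separating B → ∫ (χ A) < 2ℚ → ∫ (χ B) < 2ℚ
                          → A ≢ B → Nested A B
  light-separating-nested {A} {B} _ _ _ _ A≢B with A ⊆? B | B ⊆? A
  ... | yes A⊆B | yes B⊆A = contradiction (⊆-antisym A⊆B B⊆A) A≢B
  ... | yes A⊆B | no  B⊈A = inj₁ (A⊆B , ⊈⇒∃∈∉ B⊈A)
  ... | no  A⊈B | yes B⊆A = inj₂ (B⊆A , ⊈⇒∃∈∉ A⊈B)
  light-separating-nested {A} {B} (s∈A , t∉A , _) (s∈B , t∉B , _) A<2 B<2 _ | no A⊈B | no B⊈A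
    with ⊈⇒∃∈∉ A⊈B | ⊈⇒∃∈∉ B⊈A
  ... | u , u∈A , u∉B | v , v∈B , v∉A = contradiction 4<4 (<-irrefl refl)
    where
    open ≤-Reasoning
    4<4 : 2ℚ + 2ℚ < 2ℚ + 2ℚ
    4<4 = begin-strict
      2ℚ + 2ℚ
        ≤⟨ +-mono-≤ (difference-even s∈B t∉A u∈A u∉B) (difference-even s∈A t∉B v∈B v∉A) ⟩
      ∫ (χ (A ∩ ∁ B)) + ∫ (χ (B ∩ ∁ A))  ≤⟨ ∫-posimodular A B ⟩
      ∫ (χ A) + ∫ (χ B)                  <⟨ +-mono-< A<2 B<2 ⟩
      2ℚ + 2ℚ                            ∎

  union-step : ∀ {Q P L L' L''} → Select Q L L' → Select P L' L'' → P ⊆ Q → All (_⊆ P) L'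
             → 2ℚ * unionWeight L' + ∫ (χ Q) + ∫ (χ (Q ∩ ∁ P)) ≤ 2ℚ * unionWeight L + ∫ (χ P)
  union-step {Q} {P} {L} {L'} sel sel' P⊆Q L'⊆P = begin
    2ℚ * unionWeight L' + ∫ (χ Q) + ∫ (χ D)              ≡⟨ expand ⟨
    ∫ (λ e → 2ℚ * 𝟙 (crossesAny L' e) + χ Q e + χ D e)  ≤⟨ ∫-mono pointwise ⟩
    ∫ (λ e → 2ℚ * 𝟙 (crossesAny L e) + χ P e)          ≡⟨ ∫-2a+b (λ e → 𝟙 (crossesAny L e)) (χ P) ⟩
    2ℚ * unionWeight L + ∫ (χ P)                        ∎
    where
    open ≤-Reasoning
    D = Q ∩ ∁ P
    ∫-2a+b : ∀ a b → ∫ (λ e → 2ℚ * a e + b e) ≡ 2ℚ * ∫ a + ∫ b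
    ∫-2a+b a b = trans (∫-+ (λ e → 2ℚ * a e) b) (cong (_+ ∫ b) (∫-scale 2ℚ a))
    expand : ∫ (λ e → 2ℚ * 𝟙 (crossesAny L' e) + χ Q e + χ D e)
           ≡ 2ℚ * unionWeight L' + ∫ (χ Q) + ∫ (χ D)
    expand = trans (∫-+ (λ e → 2ℚ * 𝟙 (crossesAny L' e) + χ Q e) (χ D))
                   (cong (_+ ∫ (χ D)) (∫-2a+b (λ e → 𝟙 (crossesAny L' e)) (χ Q)))
    pointwise : ∀ e → IsEdge e
              → 2ℚ * 𝟙 (crossesAny L' e) + χ Q e + χ D e ≤ 2ℚ * 𝟙 (crossesAny L e) + χ P e
    pointwise (u , v) _ rewrite crosses-∖ Q P u v | crossesAny-select {e = (u , v)} sel =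
      chain-step-pointwise (lookup P u) (lookup P v) (lookup Q u) (lookup Q v) (crossesAny L' (u , v))
        (∈⇒T ∘ P⊆Q ∘ T⇒∈) (∈⇒T ∘ P⊆Q ∘ T⇒∈)
        (crossesAny⇒touches u v L'⊆P) (select-lookup sel' (crossesAny-All L'))

  -- Induction on the cuts below the top cut Q of a chain: the layer Q ∖ P under the next
  -- cut P is an even cut, which pays for the extra 2 on the left.
  chain-top-bound : ∀ k {Q L L'} → length L' ≡ k → Select Q L L' → All (_⊂ Q) L' → Chain L
                  → 1ℚ + 2ℚ * lengthℚ L' + ∫ (χ Q) ≤ 2ℚ * unionWeight L
  chain-top-bound zero {Q} {L' = []} _ here _ ((_ , _ , Q≥1) ∷ [] , _) = begin
    1ℚ + 2ℚ * 0ℚ + ∫ (χ Q)     ≡⟨ solve 1 (λ X → con 1ℚ :+ con 2ℚ :* con 0ℚ :+ X := con 1ℚ :+ X)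
                                          refl (∫ (χ Q)) ⟩
    1ℚ + ∫ (χ Q)               ≤⟨ +-monoˡ-≤ (∫ (χ Q)) Q≥1 ⟩
    ∫ (χ Q) + ∫ (χ Q)          ≡⟨ solve 1 (λ X → X :+ X := con 2ℚ :* X) refl (∫ (χ Q)) ⟩
    2ℚ * ∫ (χ Q)               ≡⟨ cong (2ℚ *_) (∫-cong (λ e → cong 𝟙 (sym (∨-identityʳ (crossesᵇ Q e))))) ⟩
    2ℚ * unionWeight (Q ∷ [])  ∎
    where open ≤-Reasoning
  chain-top-bound (suc k) {Q} {L} {L'@(R ∷ Rs)} |L'|≡k+1 sel below chain
    with select-top ⊂-trans R Rs (select-AllPairs sel (proj₂ chain))
  ... | P , L'' , sel' , below' = +-cancelʳ-≤ (∫ (χ P)) (begin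
    1ℚ + 2ℚ * lengthℚ L' + ∫ (χ Q) + ∫ (χ P)
      ≡⟨ cong (λ K → 1ℚ + 2ℚ * K + ∫ (χ Q) + ∫ (χ P)) (select-sum (λ _ → 1ℚ) sel') ⟩
    1ℚ + 2ℚ * (1ℚ + lengthℚ L'') + ∫ (χ Q) + ∫ (χ P)
      ≡⟨ solve 3 (λ K X Y → con 1ℚ :+ con 2ℚ :* (con 1ℚ :+ K) :+ X :+ Y
                            := con 1ℚ :+ con 2ℚ :* K :+ Y :+ (con 2ℚ :+ X))
                 refl (lengthℚ L'') (∫ (χ Q)) (∫ (χ P)) ⟩
    1ℚ + 2ℚ * lengthℚ L'' + ∫ (χ P) + (2ℚ + ∫ (χ Q))
      ≤⟨ +-mono-≤ IH (+-monoˡ-≤ (∫ (χ Q)) D≥2) ⟩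
    2ℚ * unionWeight L' + (∫ (χ D) + ∫ (χ Q))
      ≡⟨ solve 3 (λ A X Y → A :+ (Y :+ X) := A :+ X :+ Y) refl (2ℚ * unionWeight L') (∫ (χ Q)) (∫ (χ D)) ⟩
    2ℚ * unionWeight L' + ∫ (χ Q) + ∫ (χ D)
      ≤⟨ union-step sel sel' P⊆Q (unselect-All sel' (λ z → z) (All.map proj₁ below')) ⟩
    2ℚ * unionWeight L + ∫ (χ P)
      ∎)
    where
    open ≤-Reasoning
    D = Q ∩ ∁ P
    P⊆Q = proj₁ (select-lookup sel' below)
    D≥2 : 2ℚ ≤ ∫ (χ D)
    D≥2 with select-lookup sel' below | select-lookup sel' (select-All sel (proj₁ chain))
           | select-lookup sel (proj₁ chain)
    ... | _ , u , u∈Q , u∉P | s∈P , _ | _ , t∉Q , _ = difference-even s∈P t∉Q u∈Q u∉P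
    IH : 1ℚ + 2ℚ * lengthℚ L'' + ∫ (χ P) ≤ 2ℚ * unionWeight L'
    IH = chain-top-bound k (ℕ.suc-injective (trans (sym (select-length sel')) |L'|≡k+1))
                         sel' below' (select-Chain sel chain)

  chain-hall : ∀ {L} → Chain L → lengthℚ L ≤ unionWeight L
  chain-hall {[]}     _     = ∫-nonneg (λ _ _ → ≤-refl)
  chain-hall {L@(R ∷ Rs)} chain with select-top ⊂-trans R Rs (proj₂ chain)
  ... | Q , L' , sel , below = *-cancelˡ-≤-pos 2ℚ (begin
    2ℚ * lengthℚ L                  ≡⟨ cong (2ℚ *_) (select-sum (λ _ → 1ℚ) sel) ⟩
    2ℚ * (1ℚ + lengthℚ L')          ≡⟨ solve 1 (λ K → con 2ℚ :* (con 1ℚ :+ K) := con 1ℚ :+ con 2ℚ :* K :+ con 1ℚ)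
                                              refl (lengthℚ L') ⟩
    1ℚ + 2ℚ * lengthℚ L' + 1ℚ       ≤⟨ +-monoʳ-≤ (1ℚ + 2ℚ * lengthℚ L') Q≥1 ⟩
    1ℚ + 2ℚ * lengthℚ L' + ∫ (χ Q)  ≤⟨ chain-top-bound _ refl sel below chain ⟩
    2ℚ * unionWeight L              ∎)
    where
    open ≤-Reasoning
    Q≥1 = proj₂ (proj₂ (select-lookup sel (proj₁ chain)))

-- A weighted Hall inequality

module WeightedHall {n : ℕ} (x : Fin n → Fin n → ℚ) (x≥0 : ∀ u v → u Fin.< v → 0ℚ ≤ x u v)
                    (Family : List (Subset n) → Set)
                    (select-Family : ∀ {Q L L'} → Select Q L L' → Family L → Family L')
                    (hall : ∀ {L} → Family L → lengthℚ L ≤ Integral.unionWeight x x≥0 L) where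

  open Integral x x≥0

  -- Peel off the minimum weight μ: every cut of L pays μ, which the edges of ⋃ δ(L) can
  -- afford by Hall's condition; the remaining weights d - μ are handled by induction.
  weighted-hall : ∀ {L} → Family L → (d : Subset n → ℚ) (h : Edge n → ℚ)
                → All (λ Q → 0ℚ ≤ d Q) L → (∀ e → IsEdge e → 0ℚ ≤ h e)
                → All (λ Q → ∀ e → IsEdge e → Crosses Q e → d Q ≤ h e) L
                → sumℚ (map d L) ≤ ∫ h
  weighted-hall = go _ refl
    where
    go : ∀ k {L} → length L ≡ k → Family L → (d : Subset n → ℚ) (h : Edge n → ℚ)
       → All (λ Q → 0ℚ ≤ d Q) L → (∀ e → IsEdge e → 0ℚ ≤ h e)
       → All (λ Q → ∀ e → IsEdge e → Crosses Q e → d Q ≤ h e) L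
       → sumℚ (map d L) ≤ ∫ h
    go zero    {[]}       _ _ _ h _ h≥0 _ = ∫-nonneg h≥0
    go (suc k) {L@(Q₀ ∷ Qs)} |L|≡k+1 F d h d≥0 h≥0 d≤h with select-min d Q₀ Qs
    ... | m , L' , sel , μ≤ = begin
      sumℚ (map d L)                    ≡⟨ select-sum-shift d sel ⟩
      sumℚ (map d' L') + μ * lengthℚ L  ≤⟨ +-mono-≤ IH (*-monoˡ-≤-nonNeg μ {{nonNegative μ≥0}} (hall F)) ⟩
      ∫ h' + μ * unionWeight L
        ≡⟨ cong (_+ μ * unionWeight L) (∫-sub h μ (λ e → 𝟙 (crossesAny L e))) ⟩
      ∫ h - μ * unionWeight L + μ * unionWeight L
        ≡⟨ solve 3 (λ H μ U → H :- μ :* U :+ μ :* U := H) refl (∫ h) μ (unionWeight L) ⟩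
      ∫ h                               ∎
      where
      open ≤-Reasoning
      μ = d m
      μ≥0 = select-lookup sel d≥0
      d' : Subset n → ℚ
      d' Q = d Q - μ
      h' : Edge n → ℚ
      h' e = h e - μ * 𝟙 (crossesAny L e)
      μ≤h : ∀ e → IsEdge e → T (crossesAny L e) → μ ≤ h e
      μ≤h e e-ok e∈δL with All.lookupAny (All.zip (unselect-All sel ≤-refl μ≤ , d≤h)) (any⁻ _ L e∈δL)
      ... | (μ≤dQ , dQ≤h) , e∈δQ = ≤-trans μ≤dQ (dQ≤h e e-ok e∈δQ)
      d'≤h' : ∀ {Q} → (∀ e → IsEdge e → Crosses Q e → d Q ≤ h e)
                    × (∀ {e} → Crosses Q e → T (crossesAny L e))
            → ∀ e → IsEdge e → Crosses Q e → d' Q ≤ h' e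
      d'≤h' {Q} (dQ≤h , δQ⊆δL) e e-ok e∈δQ =
        subst (λ z → d Q - μ ≤ h e - z) (sym (trans (cong (μ *_) (𝟙-T (δQ⊆δL e∈δQ))) (*-identityʳ μ)))
              (+-monoˡ-≤ (- μ) (dQ≤h e e-ok e∈δQ))
      IH : sumℚ (map d' L') ≤ ∫ h'
      IH = go k (ℕ.suc-injective (trans (sym (select-length sel)) |L|≡k+1)) (select-Family sel F) d' h'
              (All.map p≤q⇒0≤q-p μ≤)
              (λ e e-ok → p≤q⇒0≤q-p (*𝟙≤ (crossesAny L e) (μ≤h e e-ok) (h≥0 e e-ok)))
              (select-All sel (All.zipWith d'≤h' (d≤h , crossesAny-All L)))

narrow-cut-edges-cost≤ : ∀ {n} (c : Fin n → Fin n → ℚ) (s t : Fin n) (x : Fin n → Fin n → ℚ) (τ : ℚ)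
  → (∀ u v → u ≢ v → 0ℚ ≤ c u v) → s ≢ t → FeasibleLP1 s t x → τ ≤ 1ℚ
  → (e : Subset n → Edge n) → (∀ Q → InNarrow s t x τ Q → MinCostEdgeOf c Q (e Q))
  → sumℚ (map (λ Q → c (proj₁ (e Q)) (proj₂ (e Q))) (narrowCuts s t x τ)) ≤ cost c x
narrow-cut-edges-cost≤ {n} c s t x τ c≥0 s≢t feasible τ≤1 e e-min =
  weighted-hall chain (cₑ ∘ e) cₑ
    (All.map (λ {Q} Q-narrow → cₑ≥0 (e Q) (proj₁ (proj₁ (e-min Q Q-narrow)))) narrow)
    cₑ≥0
    (All.map (λ {Q} Q-narrow → proj₂ (e-min Q Q-narrow)) narrow)
  where
  open FeasibleLP1 feasible
  open Integral x lower
  open Cuts x lower s t cut-even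
  open WeightedHall x lower Chain select-Chain chain-hall
  cₑ : Edge n → ℚ
  cₑ (u , v) = c u v
  cₑ≥0 : ∀ f → IsEdge f → 0ℚ ≤ cₑ f
  cₑ≥0 (u , v) u<v = c≥0 u v (<⇒≢ u<v)
  narrow : All (InNarrow s t x τ) (narrowCuts s t x τ)
  narrow = all-filter (narrow? s t x τ) (subsets n)
  separating : ∀ {Q} → InNarrow s t x τ Q → Separating Q
  separating {Q} ((st-cut , s∈Q) , _) =
    s∈Q , st-cut⇒t∉ s≢t s∈Q (proj₂ st-cut) , subst (1ℚ ≤_) (weight-δ Q) (cut-st Q st-cut)
  light : ∀ {Q} → InNarrow s t x τ Q → ∫ (χ Q) < 2ℚ
  light {Q} (_ , δQ<1+τ) = <-≤-trans (subst (_< 1ℚ + τ) (weight-δ Q) δQ<1+τ) (+-monoʳ-≤ 1ℚ τ≤1)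
  chain : Chain (narrowCuts s t x τ)
  chain = All.map separating narrow
        , Unique⇒AllPairs (λ A B → light-separating-nested (separating A) (separating B) (light A) (light B))
                          narrow (AllPairs.filter⁺ (narrow? s t x τ) (subsets-unique n))

lemma9 : (n : ℕ) (c : Fin n → Fin n → ℚ) (s t : Fin n) (x* : Fin n → Fin n → ℚ) (τ : ℚ)
         → MetricCost c → s ≢ t → OptimalLP1 s t c x*
         → 0ℚ < τ → τ ≤ 1ℚ
         → (e : Subset n → Edge n)
         → (∀ Q → InNarrow s t x* τ Q → MinCostEdgeOf c Q (e Q))
         → sumℚ (map (λ Q → c (proj₁ (e Q)) (proj₂ (e Q))) (narrowCuts s t x* τ)) ≤ cost c x*
lemma9 n c s t x* τ metric s≢t optimal _ τ≤1 =
  narrow-cut-edges-cost≤ c s t x* τ (MetricCost.nonneg metric) s≢t (OptimalLP1.feasible optimal) τ≤1
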